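{- Let $v>k>i\ge 0$ be integers with $v\ge 2k$ and $(v,k,i)\neq(2k,k,0)$, let $X=J(v,k,i)$ and $\Delta=v-2k+2i$. Let $A,B$ be vertices of $X$ and $x=|A\cap B|$. Then $A$ and $B$ have a common neighbor in $X$ if and only if $x\geq \max\{k-\Delta,\,2i-k\}$.
   Context: For integers $v>k>i\ge 0$, the generalized Johnson graph $J(v,k,i)$ is the simple undirected graph whose vertices are the $k$-element subsets of a fixed $v$-element set, two vertices $A,B$ being adjacent iff $|A\cap B|=i$. -}

module Defs where

open import Data.Nat using (ℕ; _+_; _*_; _∸_)
open import Data.Fin.Subset using (Subset; ∣_∣; _∩_)
open import Relation.Binary.PropositionalEquality using (_≡_)
open import Data.Product using (_×_; ∃-syntax)

-- Vertices of J(v,k,i): k-element subsets of Fin v (a subset together with a proof of its size).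
-- Adjacency in J(v,k,i): |A ∩ B| = i.
Adj : {v : ℕ} → ℕ → Subset v → Subset v → Set
Adj i A B = ∣ A ∩ B ∣ ≡ i

CommonNeighbour : (v k i : ℕ) → Subset v → Subset v → Set
CommonNeighbour v k i A B = ∃[ C ] (∣ C ∣ ≡ k × Adj i A C × Adj i B C)

-- Δ = v - 2k + 2i (nonnegative when v ≥ 2k)
Δ : ℕ → ℕ → ℕ → ℕ
Δ v k i = v ∸ 2 * k + 2 * i

-- A k-set C is described, as far as adjacency to A and B is concerned, by how many of its
-- elements lie in each Venn cell of A and B: a in A ∩ B, e and e′ in A ─ B and B ─ A, d outside
-- A ∪ B. Any such profile bounded by the cell sizes x, k − x, k − x, v − 2k + x is realised, and C
-- is a common neighbour iff a + e = a + e′ = i and a + e + e′ + d = k. The theorem is the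
-- solvability criterion for this small integer system, which has a solution iff it has one
-- with e as large as possible.
module Submission where

open import Defs
open import Data.Nat using (ℕ; _<_; _≤_; _*_; _∸_; _⊔_; _⊓_; _+_; suc; z≤n; s≤s)
open import Data.Nat.Properties
open import Data.Nat.Tactic.RingSolver using (solve-∀)
open import Algebra.Properties.CommutativeSemigroup +-commutativeSemigroup using (x∙yz≈y∙xz)
open import Data.Fin.Subset using (Subset; ∣_∣; _∩_; _∪_; _─_; ∁; ⊤; inside; outside)
open import Data.Fin.Subset.Properties using (∣p∩q∣≤∣p∣; ∣⊤∣≡n; ∩-comm; ∩-identityʳ)
open import Data.Vec using ([]; _∷_)
open import Data.Product using (_×_; _,_; ∃-syntax)
open import Relation.Binary.PropositionalEquality
  using (_≡_; refl; sym; trans; cong; cong₂; subst; subst₂; module ≡-Reasoning)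
open import Relation.Nullary using (¬_)
open import Function.Bundles using (_⇔_; mk⇔)
open import Function.Properties.Equivalence using () renaming (trans to ⇔-trans; sym to ⇔-sym)

∣p∩r∣≡∣[p∩q]∩r∣+∣[p─q]∩r∣ : ∀ {n} (p q r : Subset n) →
  ∣ p ∩ r ∣ ≡ ∣ (p ∩ q) ∩ r ∣ + ∣ (p ─ q) ∩ r ∣
∣p∩r∣≡∣[p∩q]∩r∣+∣[p─q]∩r∣ [] [] [] = refl
∣p∩r∣≡∣[p∩q]∩r∣+∣[p─q]∩r∣ (x ∷ p) (y ∷ q) (z ∷ r) = cell x y z
  where
  a b : ℕ
  a = ∣ (p ∩ q) ∩ r ∣
  b = ∣ (p ─ q) ∩ r ∣
  IH : ∣ p ∩ r ∣ ≡ a + b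
  IH = ∣p∩r∣≡∣[p∩q]∩r∣+∣[p─q]∩r∣ p q r
  cell : ∀ x y z → ∣ (x ∷ p) ∩ (z ∷ r) ∣ ≡ ∣ ((x ∷ p) ∩ (y ∷ q)) ∩ (z ∷ r) ∣ + ∣ ((x ∷ p) ─ (y ∷ q)) ∩ (z ∷ r) ∣
  cell inside  inside  inside  = cong suc IH
  cell inside  outside inside  = trans (cong suc IH) (sym (+-suc a b))
  cell inside  inside  outside = IH
  cell inside  outside outside = IH
  cell outside inside  _       = IH
  cell outside outside _       = IH

∣r∣≡∣[p∩q]∩r∣+∣[p─q]∩r∣+∣[q─p]∩r∣+∣∁[p∪q]∩r∣ : ∀ {n} (p q r : Subset n) →
  ∣ r ∣ ≡ ∣ (p ∩ q) ∩ r ∣ + ∣ (p ─ q) ∩ r ∣ + ∣ (q ─ p) ∩ r ∣ + ∣ ∁ (p ∪ q) ∩ r ∣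
∣r∣≡∣[p∩q]∩r∣+∣[p─q]∩r∣+∣[q─p]∩r∣+∣∁[p∪q]∩r∣ [] [] [] = refl
∣r∣≡∣[p∩q]∩r∣+∣[p─q]∩r∣+∣[q─p]∩r∣+∣∁[p∪q]∩r∣ (x ∷ p) (y ∷ q) (z ∷ r) = cell x y z
  where
  a b c d : ℕ
  a = ∣ (p ∩ q) ∩ r ∣
  b = ∣ (p ─ q) ∩ r ∣
  c = ∣ (q ─ p) ∩ r ∣
  d = ∣ ∁ (p ∪ q) ∩ r ∣
  IH : ∣ r ∣ ≡ a + b + c + d
  IH = ∣r∣≡∣[p∩q]∩r∣+∣[p─q]∩r∣+∣[q─p]∩r∣+∣∁[p∪q]∩r∣ p q r
  cell : ∀ x y z → ∣ z ∷ r ∣ ≡ ∣ ((x ∷ p) ∩ (y ∷ q)) ∩ (z ∷ r) ∣ + ∣ ((x ∷ p) ─ (y ∷ q)) ∩ (z ∷ r) ∣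
                               + ∣ ((y ∷ q) ─ (x ∷ p)) ∩ (z ∷ r) ∣ + ∣ ∁ ((x ∷ p) ∪ (y ∷ q)) ∩ (z ∷ r) ∣
  cell inside  inside  inside  = cong suc IH
  cell inside  outside inside  = trans (cong suc IH) (cong (λ t → t + c + d) (sym (+-suc a b)))
  cell outside inside  inside  = trans (cong suc IH) (cong (_+ d) (sym (+-suc (a + b) c)))
  cell outside outside inside  = trans (cong suc IH) (sym (+-suc (a + b + c) d))
  cell inside  inside  outside = IH
  cell inside  outside outside = IH
  cell outside inside  outside = IH
  cell outside outside outside = IH

∣p∣≡∣p∩q∣+∣p─q∣ : ∀ {n} (p q : Subset n) → ∣ p ∣ ≡ ∣ p ∩ q ∣ + ∣ p ─ q ∣
∣p∣≡∣p∩q∣+∣p─q∣ p q = begin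
  ∣ p ∣                             ≡⟨ cong ∣_∣ (sym (∩-identityʳ p)) ⟩
  ∣ p ∩ ⊤ ∣                         ≡⟨ ∣p∩r∣≡∣[p∩q]∩r∣+∣[p─q]∩r∣ p q ⊤ ⟩
  ∣ (p ∩ q) ∩ ⊤ ∣ + ∣ (p ─ q) ∩ ⊤ ∣ ≡⟨ cong₂ _+_ (cong ∣_∣ (∩-identityʳ (p ∩ q))) (cong ∣_∣ (∩-identityʳ (p ─ q))) ⟩
  ∣ p ∩ q ∣ + ∣ p ─ q ∣             ∎
  where open ≡-Reasoning

n≡∣p∩q∣+∣p─q∣+∣q─p∣+∣∁[p∪q]∣ : ∀ {n} (p q : Subset n) →
  n ≡ ∣ p ∩ q ∣ + ∣ p ─ q ∣ + ∣ q ─ p ∣ + ∣ ∁ (p ∪ q) ∣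
n≡∣p∩q∣+∣p─q∣+∣q─p∣+∣∁[p∪q]∣ {n} p q = begin
  n         ≡⟨ sym (∣⊤∣≡n n) ⟩
  ∣ ⊤ {n} ∣ ≡⟨ ∣r∣≡∣[p∩q]∩r∣+∣[p─q]∩r∣+∣[q─p]∩r∣+∣∁[p∪q]∩r∣ p q ⊤ ⟩
  ∣ (p ∩ q) ∩ ⊤ ∣ + ∣ (p ─ q) ∩ ⊤ ∣ + ∣ (q ─ p) ∩ ⊤ ∣ + ∣ ∁ (p ∪ q) ∩ ⊤ ∣
    ≡⟨ cong₄ (λ a b c d → a + b + c + d) (∣∩⊤∣ (p ∩ q)) (∣∩⊤∣ (p ─ q)) (∣∩⊤∣ (q ─ p)) (∣∩⊤∣ (∁ (p ∪ q))) ⟩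
  ∣ p ∩ q ∣ + ∣ p ─ q ∣ + ∣ q ─ p ∣ + ∣ ∁ (p ∪ q) ∣ ∎
  where
  open ≡-Reasoning
  ∣∩⊤∣ : (s : Subset n) → ∣ s ∩ ⊤ ∣ ≡ ∣ s ∣
  ∣∩⊤∣ s = cong ∣_∣ (∩-identityʳ s)
  cong₄ : ∀ (f : ℕ → ℕ → ℕ → ℕ → ℕ) {a a′ b b′ c c′ d d′} →
          a ≡ a′ → b ≡ b′ → c ≡ c′ → d ≡ d′ → f a b c d ≡ f a′ b′ c′ d′
  cong₄ f refl refl refl refl = refl

∣p∣≡∣q∣⇒∣p─q∣≡∣q─p∣ : ∀ {n} (p q : Subset n) → ∣ p ∣ ≡ ∣ q ∣ → ∣ p ─ q ∣ ≡ ∣ q ─ p ∣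
∣p∣≡∣q∣⇒∣p─q∣≡∣q─p∣ p q ∣p∣≡∣q∣ = +-cancelˡ-≡ ∣ p ∩ q ∣ _ _ (begin
  ∣ p ∩ q ∣ + ∣ p ─ q ∣ ≡⟨ sym (∣p∣≡∣p∩q∣+∣p─q∣ p q) ⟩
  ∣ p ∣                 ≡⟨ ∣p∣≡∣q∣ ⟩
  ∣ q ∣                 ≡⟨ ∣p∣≡∣p∩q∣+∣p─q∣ q p ⟩
  ∣ q ∩ p ∣ + ∣ q ─ p ∣ ≡⟨ cong (λ s → ∣ s ∣ + ∣ q ─ p ∣) (∩-comm q p) ⟩
  ∣ p ∩ q ∣ + ∣ q ─ p ∣ ∎)
  where open ≡-Reasoning

HasCellSizes : ∀ {n} → Subset n → Subset n → Subset n → ℕ → ℕ → ℕ → ℕ → Set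
HasCellSizes p q r a b c d =
  ∣ (p ∩ q) ∩ r ∣ ≡ a × ∣ (p ─ q) ∩ r ∣ ≡ b × ∣ (q ─ p) ∩ r ∣ ≡ c × ∣ ∁ (p ∪ q) ∩ r ∣ ≡ d

∃-subset-with-cell-sizes : ∀ {n} (p q : Subset n) {a b c d} →
  a ≤ ∣ p ∩ q ∣ → b ≤ ∣ p ─ q ∣ → c ≤ ∣ q ─ p ∣ → d ≤ ∣ ∁ (p ∪ q) ∣ →
  ∃[ r ] HasCellSizes p q r a b c d
∃-subset-with-cell-sizes [] [] z≤n z≤n z≤n z≤n = [] , refl , refl , refl , refl
∃-subset-with-cell-sizes (inside ∷ p) (inside ∷ q) z≤n hb hc hd
  with ∃-subset-with-cell-sizes p q z≤n hb hc hd
... | r , ea , eb , ec , ed = outside ∷ r , ea , eb , ec , ed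
∃-subset-with-cell-sizes (inside ∷ p) (inside ∷ q) (s≤s ha) hb hc hd
  with ∃-subset-with-cell-sizes p q ha hb hc hd
... | r , ea , eb , ec , ed = inside ∷ r , cong suc ea , eb , ec , ed
∃-subset-with-cell-sizes (inside ∷ p) (outside ∷ q) ha z≤n hc hd
  with ∃-subset-with-cell-sizes p q ha z≤n hc hd
... | r , ea , eb , ec , ed = outside ∷ r , ea , eb , ec , ed
∃-subset-with-cell-sizes (inside ∷ p) (outside ∷ q) ha (s≤s hb) hc hd
  with ∃-subset-with-cell-sizes p q ha hb hc hd
... | r , ea , eb , ec , ed = inside ∷ r , ea , cong suc eb , ec , ed
∃-subset-with-cell-sizes (outside ∷ p) (inside ∷ q) ha hb z≤n hd
  with ∃-subset-with-cell-sizes p q ha hb z≤n hd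
... | r , ea , eb , ec , ed = outside ∷ r , ea , eb , ec , ed
∃-subset-with-cell-sizes (outside ∷ p) (inside ∷ q) ha hb (s≤s hc) hd
  with ∃-subset-with-cell-sizes p q ha hb hc hd
... | r , ea , eb , ec , ed = inside ∷ r , ea , eb , cong suc ec , ed
∃-subset-with-cell-sizes (outside ∷ p) (outside ∷ q) ha hb hc z≤n
  with ∃-subset-with-cell-sizes p q ha hb hc z≤n
... | r , ea , eb , ec , ed = outside ∷ r , ea , eb , ec , ed
∃-subset-with-cell-sizes (outside ∷ p) (outside ∷ q) ha hb hc (s≤s hd)
  with ∃-subset-with-cell-sizes p q ha hb hc hd
... | r , ea , eb , ec , ed = inside ∷ r , ea , eb , ec , cong suc ed

-- x, p, r stand for the sizes of A ∩ B, A ─ B and ∁ (A ∪ B); a, e, d count the elements of a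
-- common neighbour in A ∩ B, in each of A ─ B and B ─ A (both i − a), and outside A ∪ B.
Feasible : ℕ → ℕ → ℕ → ℕ → Set
Feasible x p r i = ∃[ a ] ∃[ e ] ∃[ d ] (a ≤ x × e ≤ p × d ≤ r × a + e ≡ i × a + e + e + d ≡ x + p)

feasible⇒ : ∀ {x p r i} → Feasible x p r i → x + p ≤ i + i + r × i + i ≤ x + x + p
feasible⇒ {x} {p} {r} (a , e , d , a≤x , _ , d≤r , refl , size) = x+p≤2i+r , 2i≤2x+p
  where
  open ≤-Reasoning
  x+p≤2i+r : x + p ≤ (a + e) + (a + e) + r
  x+p≤2i+r = begin
    x + p                   ≡⟨ sym size ⟩
    (a + e) + e + d         ≤⟨ +-mono-≤ (+-monoʳ-≤ (a + e) (m≤n+m e a)) d≤r ⟩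
    (a + e) + (a + e) + r   ∎
  2i≤2x+p : (a + e) + (a + e) ≤ x + x + p
  2i≤2x+p = begin
    (a + e) + (a + e)   ≡⟨ +-assoc a e (a + e) ⟩
    a + (e + (a + e))   ≡⟨ cong (a +_) (+-comm e (a + e)) ⟩
    a + (a + e + e)     ≤⟨ +-monoʳ-≤ a (m≤m+n (a + e + e) d) ⟩
    a + (a + e + e + d) ≡⟨ cong (a +_) size ⟩
    a + (x + p)         ≤⟨ +-monoˡ-≤ (x + p) a≤x ⟩
    x + (x + p)         ≡⟨ sym (+-assoc x x p) ⟩
    x + x + p           ∎

feasible-from-e : ∀ {x p r i m e} → i + m ≡ x + p →
  e ≤ p → e ≤ i → e ≤ m → i ≤ x + e → m ≤ r + e → Feasible x p r i
feasible-from-e {x} {p} {r} {i} {m} {e} i+m≡x+p e≤p e≤i e≤m i≤x+e m≤r+e =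
  i ∸ e , e , m ∸ e , a≤x , e≤p , d≤r , m∸n+n≡m e≤i , size
  where
  a≤x : i ∸ e ≤ x
  a≤x = +-cancelʳ-≤ e (i ∸ e) x (subst (_≤ x + e) (sym (m∸n+n≡m e≤i)) i≤x+e)
  d≤r : m ∸ e ≤ r
  d≤r = +-cancelʳ-≤ e (m ∸ e) r (subst (_≤ r + e) (sym (m∸n+n≡m e≤m)) m≤r+e)
  size : i ∸ e + e + e + (m ∸ e) ≡ x + p
  size = begin
    i ∸ e + e + e + (m ∸ e)       ≡⟨ +-assoc (i ∸ e + e) e (m ∸ e) ⟩
    (i ∸ e + e) + (e + (m ∸ e))   ≡⟨ cong₂ _+_ (m∸n+n≡m e≤i) (m+[n∸m]≡n e≤m) ⟩
    i + m                         ≡⟨ i+m≡x+p ⟩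
    x + p                         ∎
    where open ≡-Reasoning

-- Writing i + m = x + p, the constraints on e are e ≤ p, e ≤ i, e ≤ m (upper) and
-- i ≤ x + e, m ≤ r + e (lower); the largest admissible choice meets every lower bound.
feasible⇐ : ∀ {x p r i} → x ≤ r → i ≤ x + p → x + p ≤ i + i + r → i + i ≤ x + x + p →
  Feasible x p r i
feasible⇐ {x} {p} {r} {i} x≤r i≤x+p x+p≤2i+r 2i≤2x+p =
  feasible-from-e i+m≡x+p (m⊓n≤m p (i ⊓ m)) e≤i e≤m i≤x+e m≤r+e
  where
  open ≤-Reasoning
  m e : ℕ
  m = x + p ∸ i
  e = p ⊓ (i ⊓ m)
  i+m≡x+p : i + m ≡ x + p
  i+m≡x+p = m+[n∸m]≡n i≤x+p
  e≤i : e ≤ i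
  e≤i = ≤-trans (m⊓n≤n p (i ⊓ m)) (m⊓n≤m i m)
  e≤m : e ≤ m
  e≤m = ≤-trans (m⊓n≤n p (i ⊓ m)) (m⊓n≤n i m)
  +e≡⊓ : ∀ y → y + e ≡ (y + p) ⊓ ((y + i) ⊓ (y + m))
  +e≡⊓ y = trans (+-distribˡ-⊓ y p (i ⊓ m)) (cong ((y + p) ⊓_) (+-distribˡ-⊓ y i m))
  i≤x+m : i ≤ x + m
  i≤x+m = +-cancelˡ-≤ i i (x + m) (begin
    i + i       ≤⟨ 2i≤2x+p ⟩
    x + x + p   ≡⟨ +-assoc x x p ⟩
    x + (x + p) ≡⟨ cong (x +_) (sym i+m≡x+p) ⟩
    x + (i + m) ≡⟨ x∙yz≈y∙xz x i m ⟩
    i + (x + m) ∎)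
  m≤r+p : m ≤ r + p
  m≤r+p = +-cancelˡ-≤ i m (r + p) (begin
    i + m       ≡⟨ i+m≡x+p ⟩
    x + p       ≤⟨ +-monoˡ-≤ p x≤r ⟩
    r + p       ≤⟨ m≤n+m (r + p) i ⟩
    i + (r + p) ∎)
  m≤r+i : m ≤ r + i
  m≤r+i = +-cancelˡ-≤ i m (r + i) (begin
    i + m       ≡⟨ i+m≡x+p ⟩
    x + p       ≤⟨ x+p≤2i+r ⟩
    i + i + r   ≡⟨ +-assoc i i r ⟩
    i + (i + r) ≡⟨ cong (i +_) (+-comm i r) ⟩
    i + (r + i) ∎)
  i≤x+e : i ≤ x + e
  i≤x+e = subst (i ≤_) (sym (+e≡⊓ x)) (⊓-glb i≤x+p (⊓-glb (m≤n+m i x) i≤x+m))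
  m≤r+e : m ≤ r + e
  m≤r+e = subst (m ≤_) (sym (+e≡⊓ r)) (⊓-glb m≤r+p (⊓-glb m≤r+i (m≤n+m m r)))

m∸n≤o⇒m≤n+o : ∀ m n {o} → m ∸ n ≤ o → m ≤ n + o
m∸n≤o⇒m≤n+o m n m∸n≤o = ≤-trans (m≤n+m∸n m n) (+-monoʳ-≤ n m∸n≤o)

2*m≡m+m : ∀ m → 2 * m ≡ m + m
2*m≡m+m m = cong (m +_) (+-identityʳ m)

2[x+p]≤x+p+p+r⇒x≤r : ∀ x p r → 2 * (x + p) ≤ x + p + p + r → x ≤ r
2[x+p]≤x+p+p+r⇒x≤r x p r 2k≤v = +-cancelʳ-≤ p x r (begin
  x + p ≤⟨ +-cancelˡ-≤ (x + p) (x + p) (p + r) (begin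
    (x + p) + (x + p) ≡⟨ sym (2*m≡m+m (x + p)) ⟩
    2 * (x + p)       ≤⟨ 2k≤v ⟩
    x + p + p + r     ≡⟨ +-assoc (x + p) p r ⟩
    (x + p) + (p + r) ∎) ⟩
  p + r ≡⟨ +-comm p r ⟩
  r + p ∎)
  where open ≤-Reasoning

Δ-criterion⇔ : ∀ {x p r w} i → x + w ≡ r →
  ((x + p) ∸ Δ (x + p + p + r) (x + p) i) ⊔ (2 * i ∸ (x + p)) ≤ x
    ⇔ (x + p ≤ i + i + r × i + i ≤ x + x + p)
Δ-criterion⇔ {x} {p} {w = w} i refl = mk⇔
  (λ h → subst (x + p ≤_) Δ+x≡2i+r (m∸n≤o⇒m≤n+o (x + p) Δ′ (m⊔n≤o⇒m≤o _ _ h))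
       , subst₂ _≤_ (2*m≡m+m i) k+x≡2x+p (m∸n≤o⇒m≤n+o (2 * i) (x + p) (m⊔n≤o⇒n≤o _ _ h)))
  (λ (h₁ , h₂) → ⊔-lub
    (m≤n+o⇒m∸n≤o (x + p) Δ′ (subst (x + p ≤_) (sym Δ+x≡2i+r) h₁))
    (m≤n+o⇒m∸n≤o (2 * i) (x + p) (subst₂ _≤_ (sym (2*m≡m+m i)) (sym k+x≡2x+p) h₂)))
  where
  Δ′ : ℕ
  Δ′ = Δ (x + p + p + (x + w)) (x + p) i
  v≡2k+w : ∀ x p w → x + p + p + (x + w) ≡ 2 * (x + p) + w
  v≡2k+w = solve-∀
  Δ+x≡2i+r : Δ′ + x ≡ i + i + (x + w)
  Δ+x≡2i+r = begin
    Δ′ + x                                   ≡⟨ cong (λ t → t ∸ 2 * (x + p) + 2 * i + x) (v≡2k+w x p w) ⟩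
    2 * (x + p) + w ∸ 2 * (x + p) + 2 * i + x ≡⟨ cong (λ t → t + 2 * i + x) (m+n∸m≡n (2 * (x + p)) w) ⟩
    w + 2 * i + x                            ≡⟨ rearrange w i x ⟩
    i + i + (x + w)                          ∎
    where
    open ≡-Reasoning
    rearrange : ∀ w i x → w + 2 * i + x ≡ i + i + (x + w)
    rearrange = solve-∀
  k+x≡2x+p : x + p + x ≡ x + x + p
  k+x≡2x+p = trans (+-comm (x + p) x) (sym (+-assoc x x p))

feasible⇔Δ-criterion : ∀ {v k i x p r} → k ≡ x + p → v ≡ x + p + p + r → 2 * k ≤ v → i < k →
  Feasible x p r i ⇔ ((k ∸ Δ v k i) ⊔ (2 * i ∸ k) ≤ x)
feasible⇔Δ-criterion {i = i} {x} {p} {r} refl refl 2k≤v i<k =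
  ⇔-trans (mk⇔ feasible⇒ (λ (h₁ , h₂) → feasible⇐ x≤r (<⇒≤ i<k) h₁ h₂))
          (⇔-sym (Δ-criterion⇔ i x+w≡r))
  where
  x≤r : x ≤ r
  x≤r = 2[x+p]≤x+p+p+r⇒x≤r x p r 2k≤v
  x+w≡r : x + (r ∸ x) ≡ r
  x+w≡r = m+[n∸m]≡n x≤r

commonNeighbour⇔feasible : ∀ {v} k i (A B : Subset v) → ∣ A ∣ ≡ k → ∣ B ∣ ≡ k →
  CommonNeighbour v k i A B ⇔ Feasible (∣ A ∩ B ∣) (∣ A ─ B ∣) (∣ ∁ (A ∪ B) ∣) i
commonNeighbour⇔feasible {v} k i A B ∣A∣≡k ∣B∣≡k = mk⇔ to from
  where
  open ≡-Reasoning
  ∣B∩r∣≡∣[A∩B]∩r∣+∣[B─A]∩r∣ : ∀ r → ∣ B ∩ r ∣ ≡ ∣ (A ∩ B) ∩ r ∣ + ∣ (B ─ A) ∩ r ∣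
  ∣B∩r∣≡∣[A∩B]∩r∣+∣[B─A]∩r∣ r =
    subst (λ s → ∣ B ∩ r ∣ ≡ ∣ s ∩ r ∣ + ∣ (B ─ A) ∩ r ∣) (∩-comm B A) (∣p∩r∣≡∣[p∩q]∩r∣+∣[p─q]∩r∣ B A r)
  x+p≡k : ∣ A ∩ B ∣ + ∣ A ─ B ∣ ≡ k
  x+p≡k = trans (sym (∣p∣≡∣p∩q∣+∣p─q∣ A B)) ∣A∣≡k
  p≡q : ∣ A ─ B ∣ ≡ ∣ B ─ A ∣
  p≡q = ∣p∣≡∣q∣⇒∣p─q∣≡∣q─p∣ A B (trans ∣A∣≡k (sym ∣B∣≡k))

  to : CommonNeighbour v k i A B → Feasible (∣ A ∩ B ∣) (∣ A ─ B ∣) (∣ ∁ (A ∪ B) ∣) i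
  to (C , ∣C∣≡k , ∣A∩C∣≡i , ∣B∩C∣≡i) =
    a , e , d , ∣p∩q∣≤∣p∣ (A ∩ B) C , ∣p∩q∣≤∣p∣ (A ─ B) C , ∣p∩q∣≤∣p∣ (∁ (A ∪ B)) C , a+e≡i , size
    where
    a e e′ d : ℕ
    a = ∣ (A ∩ B) ∩ C ∣
    e = ∣ (A ─ B) ∩ C ∣
    e′ = ∣ (B ─ A) ∩ C ∣
    d = ∣ ∁ (A ∪ B) ∩ C ∣
    a+e≡i : a + e ≡ i
    a+e≡i = trans (sym (∣p∩r∣≡∣[p∩q]∩r∣+∣[p─q]∩r∣ A B C)) ∣A∩C∣≡i
    e≡e′ : e ≡ e′
    e≡e′ = +-cancelˡ-≡ a e e′ (trans a+e≡i (trans (sym ∣B∩C∣≡i) (∣B∩r∣≡∣[A∩B]∩r∣+∣[B─A]∩r∣ C)))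
    size : a + e + e + d ≡ ∣ A ∩ B ∣ + ∣ A ─ B ∣
    size = begin
      a + e + e + d              ≡⟨ cong (λ t → a + e + t + d) e≡e′ ⟩
      a + e + e′ + d             ≡⟨ sym (∣r∣≡∣[p∩q]∩r∣+∣[p─q]∩r∣+∣[q─p]∩r∣+∣∁[p∪q]∩r∣ A B C) ⟩
      ∣ C ∣                      ≡⟨ trans ∣C∣≡k (sym x+p≡k) ⟩
      ∣ A ∩ B ∣ + ∣ A ─ B ∣      ∎

  from : Feasible (∣ A ∩ B ∣) (∣ A ─ B ∣) (∣ ∁ (A ∪ B) ∣) i → CommonNeighbour v k i A B
  from (a , e , d , a≤x , e≤p , d≤r , a+e≡i , size)
    with ∃-subset-with-cell-sizes A B a≤x e≤p (subst (e ≤_) p≡q e≤p) d≤r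
  ... | C , refl , refl , ∣[B─A]∩C∣≡e , refl = C , ∣C∣≡k , ∣A∩C∣≡i , ∣B∩C∣≡i
    where
    ∣C∣≡k : ∣ C ∣ ≡ k
    ∣C∣≡k = begin
      ∣ C ∣                                  ≡⟨ ∣r∣≡∣[p∩q]∩r∣+∣[p─q]∩r∣+∣[q─p]∩r∣+∣∁[p∪q]∩r∣ A B C ⟩
      a + e + ∣ (B ─ A) ∩ C ∣ + d            ≡⟨ cong (λ t → a + e + t + d) ∣[B─A]∩C∣≡e ⟩
      a + e + e + d                          ≡⟨ size ⟩
      ∣ A ∩ B ∣ + ∣ A ─ B ∣                  ≡⟨ x+p≡k ⟩
      k                                      ∎
    ∣A∩C∣≡i : ∣ A ∩ C ∣ ≡ i
    ∣A∩C∣≡i = trans (∣p∩r∣≡∣[p∩q]∩r∣+∣[p─q]∩r∣ A B C) a+e≡i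
    ∣B∩C∣≡i : ∣ B ∩ C ∣ ≡ i
    ∣B∩C∣≡i = trans (∣B∩r∣≡∣[A∩B]∩r∣+∣[B─A]∩r∣ C) (trans (cong (a +_) ∣[B─A]∩C∣≡e) a+e≡i)

lemma2p1 : (v k i : ℕ) → k < v → i < k → 2 * k ≤ v
    → ¬ (v ≡ 2 * k × i ≡ 0)
    → (A B : Subset v) → ∣ A ∣ ≡ k → ∣ B ∣ ≡ k
    → CommonNeighbour v k i A B ⇔ ((k ∸ Δ v k i) ⊔ (2 * i ∸ k) ≤ ∣ A ∩ B ∣)
lemma2p1 v k i _ i<k 2k≤v _ A B ∣A∣≡k ∣B∣≡k =
  ⇔-trans (commonNeighbour⇔feasible k i A B ∣A∣≡k ∣B∣≡k) (feasible⇔Δ-criterion k≡x+p v≡x+p+p+r 2k≤v i<k)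
  where
  k≡x+p : k ≡ ∣ A ∩ B ∣ + ∣ A ─ B ∣
  k≡x+p = trans (sym ∣A∣≡k) (∣p∣≡∣p∩q∣+∣p─q∣ A B)
  v≡x+p+p+r : v ≡ ∣ A ∩ B ∣ + ∣ A ─ B ∣ + ∣ A ─ B ∣ + ∣ ∁ (A ∪ B) ∣
  v≡x+p+p+r = trans (n≡∣p∩q∣+∣p─q∣+∣q─p∣+∣∁[p∪q]∣ A B)
    (cong (λ q → ∣ A ∩ B ∣ + ∣ A ─ B ∣ + q + ∣ ∁ (A ∪ B) ∣)
          (sym (∣p∣≡∣q∣⇒∣p─q∣≡∣q─p∣ A B (trans ∣A∣≡k (sym ∣B∣≡k)))))
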